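{- Let $m>n>1$ be integers. Then $(10^m-1)(10^n-1)$ is not a perfect square. -}

module Defs where

-- Let g = gcd m n, m = a g, n = b g and q = 10 ^ g. Then 10 ^ m − 1 = (q − 1) R a with
-- R a = 1 + q + ⋯ + q ^ (a − 1), and R a, R b are coprime because a, b are; so if the
-- product were a square, so would be R a, where a ≥ 2. For even a = 2c, R a = (1 + q ^ c) R c
-- with coprime factors, so 1 + q ^ c ≡ 2 (mod 3) would be a square. For odd a = 2c + 1,
-- (q ^ c, √(R a)) would solve q x² − (q − 1) y² = 1 with x even; but the automorphism of
-- this form descends from any solution to (1, 1) without changing the parity of x.
module Submission where

open import Data.Nat
open import Data.Nat.Properties
open import Data.Nat.Divisibility
open import Data.Nat.DivMod using (_/_; _%_; m/n*n≡m; m*[n/m]≡n; m%n<n; %-distribˡ-*; %-remove-+ʳ)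
open import Data.Nat.GCD using (gcd; gcd[m,n]∣m; gcd[m,n]∣n; gcd[m,n]≡0⇒m≡0; n/gcd[m,n]≢0; module Bézout)
open import Data.Nat.Coprimality using (Coprime; coprime-Bézout; coprime-/gcd; coprime-divisor)
open import Data.Nat.Induction using (<-rec)
open import Data.Nat.Tactic.RingSolver using (solve-∀)
open import Data.Integer as ℤ using (ℤ; +_; 1ℤ; ∣_∣)
import Data.Integer.Properties as ℤ
open import Data.Integer.Tactic.RingSolver renaming (solve-∀ to solve-∀ℤ)
open import Data.Product using (∃; ∃₂; _×_; _,_)
open import Relation.Nullary using (¬_; contradiction)
open import Relation.Binary.PropositionalEquality

open import Defs

gcd≢0 : ∀ m n .{{_ : NonZero m}} → NonZero (gcd m n)
gcd≢0 m n = ≢-nonZero (λ g≡0 → ≢-nonZero⁻¹ m (gcd[m,n]≡0⇒m≡0 g≡0))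

∣⇒∣^ : ∀ {d q} n .{{_ : NonZero n}} → d ∣ q → d ∣ q ^ n
∣⇒∣^ {q = q} (suc n) d∣q = ∣m⇒∣m*n (q ^ n) d∣q

2∣suc⇒nonZero : ∀ {n} → 2 ∣ suc n → NonZero n
2∣suc⇒nonZero {zero}  2∣1 = contradiction (∣1⇒≡1 2∣1) λ ()
2∣suc⇒nonZero {suc _} _   = _

repunit : ℕ → ℕ → ℕ
repunit q zero    = 0
repunit q (suc n) = 1 + q * repunit q n

repunit-+ : ∀ q m n → repunit q (m + n) ≡ repunit q m + q ^ m * repunit q n
repunit-+ q zero    n = sym (+-identityʳ (repunit q n))
repunit-+ q (suc m) n = begin
  1 + q * repunit q (m + n)                      ≡⟨ cong (λ r → 1 + q * r) (repunit-+ q m n) ⟩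
  1 + q * (repunit q m + q ^ m * repunit q n)    ≡⟨ distrib q (repunit q m) (q ^ m) (repunit q n) ⟩
  1 + q * repunit q m + q * q ^ m * repunit q n  ∎
  where
  open ≡-Reasoning
  distrib : ∀ q a b c → 1 + q * (a + b * c) ≡ 1 + q * a + q * b * c
  distrib = solve-∀

repunit-* : ∀ q m n → repunit q (n * m) ≡ repunit q m * repunit (q ^ m) n
repunit-* q m zero    = sym (*-zeroʳ (repunit q m))
repunit-* q m (suc n) = begin
  repunit q (m + n * m)                                    ≡⟨ repunit-+ q m (n * m) ⟩
  repunit q m + q ^ m * repunit q (n * m)                  ≡⟨ cong (λ r → repunit q m + q ^ m * r) (repunit-* q m n) ⟩
  repunit q m + q ^ m * (repunit q m * repunit (q ^ m) n)  ≡⟨ factor (repunit q m) (q ^ m) (repunit (q ^ m) n) ⟩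
  repunit q m * (1 + q ^ m * repunit (q ^ m) n)            ∎
  where
  open ≡-Reasoning
  factor : ∀ a b c → a + b * (a * c) ≡ a * (1 + b * c)
  factor = solve-∀

repunit∣repunit[*] : ∀ q m n → repunit q m ∣ repunit q (n * m)
repunit∣repunit[*] q m n = subst (repunit q m ∣_) (sym (repunit-* q m n)) (m∣m*n (repunit (q ^ m) n))

repunit-geometric : ∀ p n → p * repunit (suc p) n + 1 ≡ suc p ^ n
repunit-geometric p zero    = cong (_+ 1) (*-zeroʳ p)
repunit-geometric p (suc n) = begin
  p * (1 + suc p * repunit (suc p) n) + 1  ≡⟨ factor p (repunit (suc p) n) ⟩
  suc p * (p * repunit (suc p) n + 1)      ≡⟨ cong (suc p *_) (repunit-geometric p n) ⟩
  suc p * suc p ^ n                        ∎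
  where
  open ≡-Reasoning
  factor : ∀ p r → p * (1 + (1 + p) * r) + 1 ≡ (1 + p) * (p * r + 1)
  factor = solve-∀

q^n∸1≡[q∸1]*repunit : ∀ p n → suc p ^ n ∸ 1 ≡ p * repunit (suc p) n
q^n∸1≡[q∸1]*repunit p n =
  trans (cong (_∸ 1) (sym (repunit-geometric p n))) (m+n∸n≡m (p * repunit (suc p) n) 1)

-- Bézout gives t m = 1 + s n, and repunit q (1 + s n) = 1 + q * repunit q (s n).
repunit-common-divisor : ∀ q {d m n s t} → d ∣ repunit q m → d ∣ repunit q n →
                         1 + s * n ≡ t * m → d ≡ 1
repunit-common-divisor q {d} {m} {n} {s} {t} d∣Rm d∣Rn 1+sn≡tm =
  ∣1⇒≡1 (∣m+n∣m⇒∣n (subst (d ∣_) (+-comm 1 (q * repunit q (s * n))) d∣R[1+sn]) d∣qR[sn])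
  where
  d∣R[1+sn] : d ∣ repunit q (1 + s * n)
  d∣R[1+sn] = subst (λ k → d ∣ repunit q k) (sym 1+sn≡tm) (∣-trans d∣Rm (repunit∣repunit[*] q m t))
  d∣qR[sn] : d ∣ q * repunit q (s * n)
  d∣qR[sn] = ∣n⇒∣m*n q (∣-trans d∣Rn (repunit∣repunit[*] q n s))

repunit-coprime : ∀ q {m n} → Coprime m n → Coprime (repunit q m) (repunit q n)
repunit-coprime q m⊥n (d∣Rm , d∣Rn) with coprime-Bézout m⊥n
... | Bézout.+- t s eq = repunit-common-divisor q {s = s} {t} d∣Rm d∣Rn eq
... | Bézout.-+ s t eq = repunit-common-divisor q {s = s} {t} d∣Rn d∣Rm eq

coprime-*-square : ∀ {a b k} → Coprime a b → a * b ≡ k * k → ∃ λ r → a ≡ r * r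
coprime-*-square {zero}      _   _     = 0 , refl
coprime-*-square {a@(suc _)} {b} {k} a⊥b ab≡kk = g , a≡gg
  where
  g  = gcd a k
  instance _ = gcd≢0 a k
  a′ = a / g
  k′ = k / g
  a′g≡a : a′ * g ≡ a
  a′g≡a = m/n*n≡m (gcd[m,n]∣m a k)
  k′g≡k : k′ * g ≡ k
  k′g≡k = m/n*n≡m (gcd[m,n]∣n a k)
  a′b≡k′k′g : a′ * b ≡ k′ * (k′ * g)
  a′b≡k′k′g = *-cancelʳ-≡ _ _ g (begin
    a′ * b * g              ≡⟨ swap a′ b g ⟩
    a′ * g * b              ≡⟨ cong (_* b) a′g≡a ⟩
    a * b                   ≡⟨ ab≡kk ⟩
    k * k                   ≡⟨ cong₂ _*_ k′g≡k k′g≡k ⟨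
    k′ * g * (k′ * g)       ≡⟨ regroup k′ g ⟩
    k′ * (k′ * g) * g       ∎)
    where
    open ≡-Reasoning
    swap : ∀ a b g → a * b * g ≡ a * g * b
    swap = solve-∀
    regroup : ∀ k g → k * g * (k * g) ≡ k * (k * g) * g
    regroup = solve-∀
  a′∣g : a′ ∣ g
  a′∣g = coprime-divisor a′⊥k′ (coprime-divisor a′⊥k′
           (divides b (trans (sym a′b≡k′k′g) (*-comm a′ b))))
    where a′⊥k′ = coprime-/gcd a k
  g∣a′ : g ∣ a′
  g∣a′ = coprime-divisor g⊥b
           (divides (k′ * k′) (trans (*-comm b a′) (trans a′b≡k′k′g (sym (*-assoc k′ k′ g)))))
    where
    g⊥b : Coprime g b
    g⊥b (d∣g , d∣b) = a⊥b (∣-trans d∣g (gcd[m,n]∣m a k) , d∣b)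
  a≡gg : a ≡ g * g
  a≡gg = trans (sym a′g≡a) (cong (_* g) (∣-antisym a′∣g g∣a′))

square-cancel : ∀ m {n k} .{{_ : NonZero m}} → m * m * n ≡ k * k → ∃ λ r → n ≡ r * r
square-cancel m {n} {k} mmn≡kk = k′ , n≡k′k′
  where
  g  = gcd m k
  instance _ = gcd≢0 m k
  m′ = m / g
  k′ = k / g
  m′m′n≡k′k′ : m′ * m′ * n ≡ k′ * k′
  m′m′n≡k′k′ = *-cancelʳ-≡ _ _ (g * g) {{m*n≢0 g g}} (begin
    m′ * m′ * n * (g * g)     ≡⟨ regroup m′ g n ⟩
    m′ * g * (m′ * g) * n     ≡⟨ cong (λ x → x * x * n) (m/n*n≡m (gcd[m,n]∣m m k)) ⟩
    m * m * n                 ≡⟨ mmn≡kk ⟩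
    k * k                     ≡⟨ cong (λ x → x * x) (m/n*n≡m (gcd[m,n]∣n m k)) ⟨
    k′ * g * (k′ * g)         ≡⟨ regroup′ k′ g ⟩
    k′ * k′ * (g * g)         ∎)
    where
    open ≡-Reasoning
    regroup : ∀ m g n → m * m * n * (g * g) ≡ m * g * (m * g) * n
    regroup = solve-∀
    regroup′ : ∀ k g → k * g * (k * g) ≡ k * k * (g * g)
    regroup′ = solve-∀
  m′≡1 : m′ ≡ 1
  m′≡1 = m′⊥k′ (∣-refl , coprime-divisor m′⊥k′
           (divides (m′ * n) (trans (sym m′m′n≡k′k′) (swap m′ n))))
    where
    m′⊥k′ = coprime-/gcd m k
    swap : ∀ m n → m * m * n ≡ m * n * m
    swap = solve-∀
  n≡k′k′ : n ≡ k′ * k′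
  n≡k′k′ = trans (sym (*-identityˡ n)) (trans (cong (λ x → x * x * n) (sym m′≡1)) m′m′n≡k′k′)

square%3≢2 : ∀ t → t * t % 3 ≢ 2
square%3≢2 t t²%3≡2 = residue (t % 3) (m%n<n t 3) (trans (sym (%-distribˡ-* t t 3)) t²%3≡2)
  where
  residue : ∀ j → j < 3 → j * j % 3 ≢ 2
  residue 0 _ ()
  residue 1 _ ()
  residue 2 _ ()
  residue (suc (suc (suc _))) (s≤s (s≤s (s≤s ())))

PellSolution : ℕ → ℕ → ℕ → Set
PellSolution p x y = suc p * (x * x) ≡ p * (y * y) + 1

PellSolutionℤ : ℤ → ℤ → ℤ → Set
PellSolutionℤ P X Y = (1ℤ ℤ.+ P) ℤ.* (X ℤ.* X) ≡ P ℤ.* (Y ℤ.* Y) ℤ.+ 1ℤ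

pellSolution⇒pellSolutionℤ : ∀ {p x y} → PellSolution p x y → PellSolutionℤ (+ p) (+ x) (+ y)
pellSolution⇒pellSolutionℤ {p} {x} {y} sol = begin
  (1ℤ ℤ.+ + p) ℤ.* (+ x ℤ.* + x)   ≡⟨ cong₂ ℤ._*_ (ℤ.pos-+ 1 p) (ℤ.pos-* x x) ⟨
  + suc p ℤ.* + (x * x)             ≡⟨ ℤ.pos-* (suc p) (x * x) ⟨
  + (suc p * (x * x))               ≡⟨ cong +_ sol ⟩
  + (p * (y * y) + 1)               ≡⟨ ℤ.pos-+ (p * (y * y)) 1 ⟩
  + (p * (y * y)) ℤ.+ 1ℤ            ≡⟨ cong (ℤ._+ 1ℤ) (ℤ.pos-* p (y * y)) ⟩
  + p ℤ.* + (y * y) ℤ.+ 1ℤ          ≡⟨ cong (λ s → + p ℤ.* s ℤ.+ 1ℤ) (ℤ.pos-* y y) ⟩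
  + p ℤ.* (+ y ℤ.* + y) ℤ.+ 1ℤ      ∎
  where open ≡-Reasoning

pellSolutionℤ⇒pellSolution : ∀ {p x} Y → PellSolutionℤ (+ p) (+ x) Y → PellSolution p x ∣ Y ∣
pellSolutionℤ⇒pellSolution {p} {x} Y sol = ℤ.+-injective (begin
  + (suc p * (x * x))               ≡⟨ ℤ.pos-* (suc p) (x * x) ⟩
  + suc p ℤ.* + (x * x)             ≡⟨ cong₂ ℤ._*_ (ℤ.pos-+ 1 p) (ℤ.pos-* x x) ⟩
  (1ℤ ℤ.+ + p) ℤ.* (+ x ℤ.* + x)   ≡⟨ sol ⟩
  + p ℤ.* (Y ℤ.* Y) ℤ.+ 1ℤ          ≡⟨ cong (λ s → + p ℤ.* s ℤ.+ 1ℤ) (square-∣∣ Y) ⟨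
  + p ℤ.* + (∣ Y ∣ * ∣ Y ∣) ℤ.+ 1ℤ  ≡⟨ cong (ℤ._+ 1ℤ) (ℤ.pos-* p (∣ Y ∣ * ∣ Y ∣)) ⟨
  + (p * (∣ Y ∣ * ∣ Y ∣)) ℤ.+ 1ℤ    ≡⟨ ℤ.pos-+ (p * (∣ Y ∣ * ∣ Y ∣)) 1 ⟨
  + (p * (∣ Y ∣ * ∣ Y ∣) + 1)       ∎)
  where
  open ≡-Reasoning
  square-∣∣ : ∀ Y → + (∣ Y ∣ * ∣ Y ∣) ≡ Y ℤ.* Y
  square-∣∣ (+ n)      = ℤ.pos-* n n
  square-∣∣ ℤ.-[1+ n ] = refl

-- The inverse of the automorphism (X, Y) ↦ ((2P+1)X + 2PY, (2P+2)X + (2P+1)Y)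
-- of the form (P+1)X² − PY².
descentˣ descentʸ : ℤ → ℤ → ℤ → ℤ
descentˣ P X Y = (1ℤ ℤ.+ + 2 ℤ.* P) ℤ.* X ℤ.- + 2 ℤ.* P ℤ.* Y
descentʸ P X Y = (1ℤ ℤ.+ + 2 ℤ.* P) ℤ.* Y ℤ.- (+ 2 ℤ.+ + 2 ℤ.* P) ℤ.* X

pellSolutionℤ-descent : ∀ P X Y → PellSolutionℤ P X Y →
                        PellSolutionℤ P (descentˣ P X Y) (descentʸ P X Y)
pellSolutionℤ-descent P X Y sol = begin
  (1ℤ ℤ.+ P) ℤ.* (X′ ℤ.* X′)                       ≡⟨ form-invariant P X Y ⟩
  PY′² ℤ.+ ((1ℤ ℤ.+ P) ℤ.* (X ℤ.* X) ℤ.- PY²)      ≡⟨ cong (λ c → PY′² ℤ.+ (c ℤ.- PY²)) sol ⟩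
  PY′² ℤ.+ (PY² ℤ.+ 1ℤ ℤ.- PY²)                    ≡⟨ cancel PY′² PY² ⟩
  PY′² ℤ.+ 1ℤ                                      ∎
  where
  open ≡-Reasoning
  X′ = descentˣ P X Y
  Y′ = descentʸ P X Y
  PY² = P ℤ.* (Y ℤ.* Y)
  PY′² = P ℤ.* (Y′ ℤ.* Y′)
  form-invariant : ∀ P X Y →
    let X′ = (1ℤ ℤ.+ + 2 ℤ.* P) ℤ.* X ℤ.- + 2 ℤ.* P ℤ.* Y
        Y′ = (1ℤ ℤ.+ + 2 ℤ.* P) ℤ.* Y ℤ.- (+ 2 ℤ.+ + 2 ℤ.* P) ℤ.* X
    in (1ℤ ℤ.+ P) ℤ.* (X′ ℤ.* X′)
         ≡ P ℤ.* (Y′ ℤ.* Y′) ℤ.+ ((1ℤ ℤ.+ P) ℤ.* (X ℤ.* X) ℤ.- P ℤ.* (Y ℤ.* Y))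
  form-invariant = solve-∀ℤ
  cancel : ∀ A B → A ℤ.+ (B ℤ.+ 1ℤ ℤ.- B) ≡ A ℤ.+ 1ℤ
  cancel = solve-∀ℤ

pell-x<y : ∀ {p x y} → 2 ≤ x → PellSolution p x y → x < y
pell-x<y {p} {x} {y} 2≤x sol =
  ≰⇒> λ y≤x → <⇒≱ (≤-trans (s≤s (s≤s z≤n)) (*-mono-≤ 2≤x 2≤x)) (xx≤1 y≤x)
  where
  open ≤-Reasoning
  xx≤1 : y ≤ x → x * x ≤ 1
  xx≤1 y≤x = +-cancelʳ-≤ (p * (x * x)) (x * x) 1 (begin
    x * x + p * (x * x)  ≡⟨ sol ⟩
    p * (y * y) + 1      ≤⟨ +-monoˡ-≤ 1 (*-monoʳ-≤ p (*-mono-≤ y≤x y≤x)) ⟩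
    p * (x * x) + 1      ≡⟨ +-comm (p * (x * x)) 1 ⟩
    1 + p * (x * x)      ∎)

pell-descent-nonneg : ∀ {p x y} → PellSolution p x y → 2 * p * y ≤ (1 + 2 * p) * x
pell-descent-nonneg {p} {x} {y} sol = ≮⇒≥ λ L<R → <⇒≱ (*-mono-< L<R L<R) RR≤LL
  where
  L = (1 + 2 * p) * x
  R = 2 * p * y
  open ≤-Reasoning
  RR≤LL : R * R ≤ L * L
  RR≤LL = begin
    R * R                                  ≤⟨ m≤n+m (R * R) (x * x + 4 * p) ⟩
    x * x + 4 * p + R * R                  ≡⟨ square-R p x y ⟨
    x * x + 4 * p * (p * (y * y) + 1)      ≡⟨ cong (λ s → x * x + 4 * p * s) sol ⟨
    x * x + 4 * p * (suc p * (x * x))      ≡⟨ square-L p x ⟨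
    L * L                                  ∎
    where
    square-L : ∀ p x → (1 + 2 * p) * x * ((1 + 2 * p) * x) ≡ x * x + 4 * p * ((1 + p) * (x * x))
    square-L = solve-∀
    square-R : ∀ p x y → x * x + 4 * p * (p * (y * y) + 1) ≡ x * x + 4 * p + 2 * p * y * (2 * p * y)
    square-R = solve-∀

pell-descent : ∀ {p x y} .{{_ : NonZero p}} → 2 ≤ x → PellSolution p x y →
               ∃₂ λ x′ y′ → x′ < x × (2 ∣ x → 2 ∣ x′) × PellSolution p x′ y′
pell-descent {p} {x} {y} 2≤x sol =
  x′ , ∣ Y′ ∣ , x′<x , 2∣x′ , pellSolutionℤ⇒pellSolution {p} {x′} Y′ sol′
  where
  L = (1 + 2 * p) * x
  R = 2 * p * y
  x′ = L ∸ R
  R+x′≡L : R + x′ ≡ L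
  R+x′≡L = m+[n∸m]≡n (pell-descent-nonneg {p} {x} {y} sol)
  x′<x : x′ < x
  x′<x = +-cancelˡ-< R x′ x (begin-strict
    R + x′         ≡⟨ R+x′≡L ⟩
    L              ≡⟨⟩
    x + 2 * p * x  <⟨ +-monoʳ-< x (*-monoʳ-< (2 * p) {{m*n≢0 2 p}} (pell-x<y {p} {x} {y} 2≤x sol)) ⟩
    x + R          ≡⟨ +-comm x R ⟩
    R + x          ∎)
    where open ≤-Reasoning
  2∣x′ : 2 ∣ x → 2 ∣ x′
  2∣x′ 2∣x = ∣m+n∣m⇒∣n (subst (2 ∣_) (sym R+x′≡L) (∣n⇒∣m*n (1 + 2 * p) 2∣x)) 2∣R
    where
    2∣R : 2 ∣ R
    2∣R = ∣m⇒∣m*n y (∣m⇒∣m*n p ∣-refl)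
  P = + p
  X = + x
  Y = + y
  Y′ = descentʸ P X Y
  x′≡X′ : + x′ ≡ descentˣ P X Y
  x′≡X′ = begin
    + x′                           ≡⟨ add-sub (+ R) (+ x′) ⟩
    + R ℤ.+ + x′ ℤ.- + R           ≡⟨ cong (ℤ._- + R) (trans (sym (ℤ.pos-+ R x′)) (cong +_ R+x′≡L)) ⟩
    + L ℤ.- + R                    ≡⟨ cong₂ ℤ._-_ +L≡ +R≡ ⟩
    descentˣ P X Y                 ∎
    where
    open ≡-Reasoning
    add-sub : ∀ A B → B ≡ A ℤ.+ B ℤ.- A
    add-sub = solve-∀ℤ
    +L≡ : + L ≡ (1ℤ ℤ.+ + 2 ℤ.* P) ℤ.* X
    +L≡ = trans (ℤ.pos-* (1 + 2 * p) x)
                (cong (ℤ._* X) (trans (ℤ.pos-+ 1 (2 * p)) (cong (λ A → 1ℤ ℤ.+ A) (ℤ.pos-* 2 p))))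
    +R≡ : + R ≡ + 2 ℤ.* P ℤ.* Y
    +R≡ = trans (ℤ.pos-* (2 * p) y) (cong (ℤ._* Y) (ℤ.pos-* 2 p))
  sol′ : PellSolutionℤ P (+ x′) Y′
  sol′ = subst (λ X′ → PellSolutionℤ P X′ Y′) (sym x′≡X′)
               (pellSolutionℤ-descent P X Y (pellSolution⇒pellSolutionℤ {p} {x} {y} sol))

pell-solution-odd : ∀ {p} .{{_ : NonZero p}} x {y} → PellSolution p x y → ¬ 2 ∣ x
pell-solution-odd {p} = <-rec (λ x → ∀ {y} → PellSolution p x y → ¬ 2 ∣ x) descend
  where
  descend : ∀ x → (∀ {x′} → x′ < x → ∀ {y} → PellSolution p x′ y → ¬ 2 ∣ x′) →
            ∀ {y} → PellSolution p x y → ¬ 2 ∣ x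
  descend zero                _   sol _   = 0≢1+n (trans (sym (*-zeroʳ (suc p))) (trans sol (+-comm _ 1)))
  descend (suc zero)          _   _   2∣1 = contradiction (∣1⇒≡1 2∣1) λ ()
  descend x@(suc (suc _)) rec {y} sol 2∣x =
    let _ , y′ , x′<x , even⇒even , sol′ = pell-descent {p} {x} {y} (s≤s (s≤s z≤n)) sol
    in rec x′<x {y′} sol′ (even⇒even 2∣x)

data EvenOrOdd : ℕ → Set where
  even : ∀ c → EvenOrOdd (c + c)
  odd  : ∀ c → EvenOrOdd (suc (c + c))

evenOrOdd : ∀ n → EvenOrOdd n
evenOrOdd zero    = even 0
evenOrOdd (suc n) with evenOrOdd n
... | even c = odd c
... | odd c  = subst EvenOrOdd (cong suc (+-suc c c)) (even (suc c))

repunit-even-not-square : ∀ p c → 3 ∣ p → 2 ∣ suc p →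
                          ¬ ∃ λ r → repunit (suc p) (suc c + suc c) ≡ r * r
repunit-even-not-square p c 3∣p 2∣q (r , R≡rr) =
  let t , 1+qᶜ≡tt = coprime-*-square {1 + q ^ c′} {Rᶜ} {r} 1+qᶜ⊥Rᶜ (trans (sym (repunit-+ q c′ c′)) R≡rr)
  in square%3≢2 t (subst (λ n → n % 3 ≡ 2) 1+qᶜ≡tt 1+qᶜ%3≡2)
  where
  q  = suc p
  c′ = suc c
  Rᶜ = repunit q c′
  1+qᶜ≡2+pRᶜ : 1 + q ^ c′ ≡ 2 + p * Rᶜ
  1+qᶜ≡2+pRᶜ = cong suc (trans (sym (repunit-geometric p c′)) (+-comm (p * Rᶜ) 1))
  1+qᶜ⊥Rᶜ : Coprime (1 + q ^ c′) Rᶜ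
  1+qᶜ⊥Rᶜ {d} (d∣1+qᶜ , d∣Rᶜ) =
    ∣1⇒≡1 (∣m+n∣m⇒∣n (subst (d ∣_) (+-comm 1 (q ^ c′)) d∣1+qᶜ) d∣qᶜ)
    where
    d∣2 : d ∣ 2
    d∣2 = ∣m+n∣m⇒∣n (subst (d ∣_) (trans 1+qᶜ≡2+pRᶜ (+-comm 2 (p * Rᶜ))) d∣1+qᶜ)
                    (∣n⇒∣m*n p d∣Rᶜ)
    d∣qᶜ : d ∣ q ^ c′
    d∣qᶜ = ∣-trans d∣2 (∣m⇒∣m*n (q ^ c) 2∣q)
  1+qᶜ%3≡2 : (1 + q ^ c′) % 3 ≡ 2
  1+qᶜ%3≡2 = trans (cong (_% 3) 1+qᶜ≡2+pRᶜ) (%-remove-+ʳ 2 (∣m⇒∣m*n Rᶜ 3∣p))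

repunit-odd-not-square : ∀ p c .{{_ : NonZero p}} → 2 ∣ suc p →
                         ¬ ∃ λ r → repunit (suc p) (suc (suc c + suc c)) ≡ r * r
repunit-odd-not-square p c 2∣q (r , R≡rr) = pell-solution-odd (q ^ c′) {r} sol (∣m⇒∣m*n (q ^ c) 2∣q)
  where
  q  = suc p
  c′ = suc c
  sol : PellSolution p (q ^ c′) r
  sol = begin
    q * (q ^ c′ * q ^ c′)                   ≡⟨ cong (q *_) (^-distribˡ-+-* q c′ c′) ⟨
    q ^ suc (c′ + c′)                       ≡⟨ repunit-geometric p (suc (c′ + c′)) ⟨
    p * repunit q (suc (c′ + c′)) + 1      ≡⟨ cong (λ s → p * s + 1) R≡rr ⟩
    p * (r * r) + 1                         ∎
    where open ≡-Reasoning

repunit-not-square : ∀ p → 3 ∣ p → 2 ∣ suc p → ∀ {a} → 2 ≤ a →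
                     ¬ ∃ λ r → repunit (suc p) a ≡ r * r
repunit-not-square p 3∣p 2∣q {a} 2≤a with evenOrOdd a
... | even zero    = contradiction 2≤a λ ()
... | odd zero     = contradiction 2≤a λ { (s≤s ()) }
... | even (suc c) = repunit-even-not-square p c 3∣p 2∣q
... | odd (suc c)  = repunit-odd-not-square p c {{2∣suc⇒nonZero 2∣q}} 2∣q

repunit-product-not-square : ∀ p → 3 ∣ p → 2 ∣ suc p → ∀ {a b} → Coprime a b → 2 ≤ a →
                             ¬ ∃ λ k → k * k ≡ (suc p ^ a ∸ 1) * (suc p ^ b ∸ 1)
repunit-product-not-square p 3∣p 2∣q {a} {b} a⊥b 2≤a (k , k²≡) =
  let s , RᵃRᵇ≡ss = square-cancel p {Rᵃ * Rᵇ} {k} {{2∣suc⇒nonZero 2∣q}} ppRᵃRᵇ≡kk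
      r , Rᵃ≡rr   = coprime-*-square {Rᵃ} {Rᵇ} {s} (repunit-coprime q a⊥b) RᵃRᵇ≡ss
  in repunit-not-square p 3∣p 2∣q 2≤a (r , Rᵃ≡rr)
  where
  q  = suc p
  Rᵃ = repunit q a
  Rᵇ = repunit q b
  ppRᵃRᵇ≡kk : p * p * (Rᵃ * Rᵇ) ≡ k * k
  ppRᵃRᵇ≡kk = begin
    p * p * (Rᵃ * Rᵇ)                ≡⟨ interchange p Rᵃ Rᵇ ⟩
    p * Rᵃ * (p * Rᵇ)                ≡⟨ cong₂ _*_ (q^n∸1≡[q∸1]*repunit p a) (q^n∸1≡[q∸1]*repunit p b) ⟨
    (q ^ a ∸ 1) * (q ^ b ∸ 1)        ≡⟨ k²≡ ⟨
    k * k                            ∎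
    where
    open ≡-Reasoning
    interchange : ∀ p x y → p * p * (x * y) ≡ p * x * (p * y)
    interchange = solve-∀

-- Dividing m and n by g = gcd m n replaces the base q by q ^ g, which is again ≡ 4 (mod 6).
power-product-not-square : ∀ p → 3 ∣ p → 2 ∣ suc p → ∀ {m n} → 0 < n → n < m →
                           ¬ ∃ λ k → k * k ≡ (suc p ^ m ∸ 1) * (suc p ^ n ∸ 1)
power-product-not-square p 3∣p 2∣q {m} {n} 0<n n<m (k , k²≡) =
  repunit-product-not-square P 3∣P 2∣Q (coprime-/gcd m n) 2≤m/g
    (k , subst₂ (λ u v → k * k ≡ (u ∸ 1) * (v ∸ 1))
                (q^l≡Q^[l/g] (gcd[m,n]∣m m n)) (q^l≡Q^[l/g] (gcd[m,n]∣n m n)) k²≡)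
  where
  q = suc p
  g = gcd m n
  instance _ = gcd≢0 m n {{>-nonZero (<-trans 0<n n<m)}}
  P = p * repunit q g
  q^g≡1+P : q ^ g ≡ suc P
  q^g≡1+P = trans (sym (repunit-geometric p g)) (+-comm P 1)
  3∣P : 3 ∣ P
  3∣P = ∣m⇒∣m*n (repunit q g) 3∣p
  2∣Q : 2 ∣ suc P
  2∣Q = subst (2 ∣_) q^g≡1+P (∣⇒∣^ g 2∣q)
  q^l≡Q^[l/g] : ∀ {l} → g ∣ l → q ^ l ≡ suc P ^ (l / g)
  q^l≡Q^[l/g] {l} g∣l = begin
    q ^ l              ≡⟨ cong (q ^_) (m*[n/m]≡n g∣l) ⟨
    q ^ (g * (l / g))  ≡⟨ ^-*-assoc q g (l / g) ⟨
    (q ^ g) ^ (l / g)  ≡⟨ cong (_^ (l / g)) q^g≡1+P ⟩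
    suc P ^ (l / g)    ∎
    where open ≡-Reasoning
  2≤m/g : 2 ≤ m / g
  2≤m/g = ≤-trans (s≤s (n≢0⇒n>0 (n/gcd[m,n]≢0 m n {{>-nonZero 0<n}}))) n/g<m/g
    where
    n/g<m/g : n / g < m / g
    n/g<m/g = *-cancelʳ-< g (n / g) (m / g)
      (subst₂ _<_ (sym (m/n*n≡m (gcd[m,n]∣n m n))) (sym (m/n*n≡m (gcd[m,n]∣m m n))) n<m)

proposition25 : (m n : ℕ) → 1 < n → n < m →
    ¬ (∃ λ k → k * k ≡ (10 ^ m ∸ 1) * (10 ^ n ∸ 1))
proposition25 m n 1<n n<m = power-product-not-square 9 (divides 3 refl) (divides 5 refl) (<-trans z<s 1<n) n<m
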